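{- Let $A$ be a finite algebra. If the power graph $\Gamma$ of $A$ is equal to the enhanced power graph of $A$, or to the intersection power graph of $A$, then $\Gamma$ is a cograph.
   Context: An algebra is a set $A$ with a collection of operations of various finite arities (nullary operations give constants). For $S\subseteq A$, $\langle S\rangle$ is the subalgebra generated by $S$; $\langle x\rangle=\langle\{x\}\rangle$. $E(A)=\langle\emptyset\rangle$ is the smallest subalgebra (possibly empty). Graphs are simple with vertex set $A$. Power graph: distinct $x,y$ adjacent iff $x\in\langle y\rangle$ or $y\in\langle x\rangle$. Enhanced power graph: distinct $x,y$ adjacent iff there is $z\in A$ with $x,y\in\langle z\rangle$. Intersection power graph: distinct $x,y$ adjacent iff $x\in E(A)$ or $y\in E(A)$ or $\langle x\rangle\cap\langle y\rangle$ properly contains $E(A)$. A cograph is a graph with no induced subgraph isomorphic to the path on $4$ vertices. -}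

module Defs where

open import Data.Nat using (ℕ)
open import Data.Fin using (Fin)
open import Data.Product using (Σ; ∃; _×_; _,_)
open import Data.Sum using (_⊎_)
open import Relation.Nullary using (¬_)
open import Data.Empty using (⊥)
open import Relation.Binary.PropositionalEquality using (_≡_; _≢_)
open import Function.Bundles using (_⇔_)

-- A finite algebra: carrier Fin n (any finite set is in bijection with some Fin n),
-- an arbitrary index type of operation symbols, each with a finite arity.
-- Nullary operations (arity 0) are constants.
record FiniteAlgebra (n : ℕ) : Set₁ where
  field
    Op    : Set
    arity : Op → ℕ
    op    : (o : Op) → (Fin (arity o) → Fin n) → Fin n

module _ {n : ℕ} (A : FiniteAlgebra n) where
  open FiniteAlgebra A

  data ⟨_⟩ (S : Fin n → Set) : Fin n → Set where
    gen : ∀ {x} → S x → ⟨ S ⟩ x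
    app : (o : Op) (args : Fin (arity o) → Fin n) →
          ((k : Fin (arity o)) → ⟨ S ⟩ (args k)) → ⟨ S ⟩ (op o args)

  ⟨_⟩₁ : Fin n → Fin n → Set
  ⟨ x ⟩₁ = ⟨ (λ z → z ≡ x) ⟩

  E : Fin n → Set
  E = ⟨ (λ _ → ⊥) ⟩

  PowerAdj : Fin n → Fin n → Set
  PowerAdj x y = x ≢ y × (⟨ y ⟩₁ x ⊎ ⟨ x ⟩₁ y)

  EnhancedAdj : Fin n → Fin n → Set
  EnhancedAdj x y = x ≢ y × ∃ λ z → ⟨ z ⟩₁ x × ⟨ z ⟩₁ y

  -- intersection power graph: ⟨x⟩ ∩ ⟨y⟩ properly contains E(A)
  -- (E(A) ⊆ ⟨x⟩ ∩ ⟨y⟩ always holds, so proper containment means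
  --  some element of ⟨x⟩ ∩ ⟨y⟩ lies outside E(A))
  IntersectionAdj : Fin n → Fin n → Set
  IntersectionAdj x y =
    x ≢ y × (E x ⊎ E y ⊎ (∃ λ w → ⟨ x ⟩₁ w × ⟨ y ⟩₁ w × ¬ E w))

SameGraph : {n : ℕ} → (Fin n → Fin n → Set) → (Fin n → Fin n → Set) → Set
SameGraph {n} R Q = (x y : Fin n) → R x y ⇔ Q x y

InducedP4 : {n : ℕ} → (Fin n → Fin n → Set) → Fin n → Fin n → Fin n → Fin n → Set
InducedP4 R a b c d =
  a ≢ b × a ≢ c × a ≢ d × b ≢ c × b ≢ d × c ≢ d ×
  R a b × R b c × R c d × ¬ R a c × ¬ R b d × ¬ R a d

IsCograph : {n : ℕ} → (Fin n → Fin n → Set) → Set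
IsCograph {n} R = (a b c d : Fin n) → ¬ InducedP4 R a b c d

-- The relation x ∈ ⟨y⟩ is a preorder and the power graph is its comparability graph.
-- Hence in an induced path x - y - z of the power graph the middle vertex y is either
-- below both ends or above both ends. If the power graph equals the enhanced power
-- graph, y cannot be above both (x, z ∈ ⟨y⟩ would make x, z adjacent); if it equals
-- the intersection power graph, y cannot be below both unless y ∈ E(A)
-- (y ∈ ⟨x⟩ ∩ ⟨z⟩ would make x, z adjacent), and an element of E(A) is adjacent to
-- every other vertex. In an induced path a - b - c - d both inner vertices are such
-- middles, so they lie on the same side, and transitivity through b and c makes a
-- and c adjacent.
module Submission where

open import Defs
open import Data.Nat using (ℕ)
open import Data.Fin using (Fin)
open import Data.Sum using (_⊎_; inj₁; inj₂)
open import Data.Product using (_×_; _,_)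
open import Data.Empty using (⊥-elim)
open import Function using (_∘_)
open import Relation.Nullary using (¬_)
open import Relation.Binary.PropositionalEquality using (_≢_; refl; ≢-sym)
open import Function.Bundles using (Equivalence)

InducedP3 : {n : ℕ} → (Fin n → Fin n → Set) → Fin n → Fin n → Fin n → Set
InducedP3 R x y z = x ≢ z × R x y × R y z × ¬ R x z

module _ {n : ℕ} (A : FiniteAlgebra n) where

  infix 4 _∈⟨_⟩

  _∈⟨_⟩ : Fin n → Fin n → Set
  x ∈⟨ y ⟩ = ⟨ A ⟩₁ y x

  ⟨⟩-least : {S T : Fin n → Set} → (∀ {s} → S s → ⟨ A ⟩ T s) →
             ∀ {x} → ⟨ A ⟩ S x → ⟨ A ⟩ T x
  ⟨⟩-least S⊆T (gen s)          = S⊆T s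
  ⟨⟩-least S⊆T (app o args ind) = app o args (λ k → ⟨⟩-least S⊆T (ind k))

  ∈⟨⟩-trans : ∀ {x y z} → x ∈⟨ y ⟩ → y ∈⟨ z ⟩ → x ∈⟨ z ⟩
  ∈⟨⟩-trans x∈y y∈z = ⟨⟩-least (λ { refl → y∈z }) x∈y

  E⊆∈⟨⟩ : ∀ {x y} → E A x → x ∈⟨ y ⟩
  E⊆∈⟨⟩ = ⟨⟩-least (λ ())

  PowerAdj-sym : ∀ {x y} → PowerAdj A x y → PowerAdj A y x
  PowerAdj-sym (x≢y , inj₁ x∈y) = ≢-sym x≢y , inj₂ x∈y
  PowerAdj-sym (x≢y , inj₂ y∈x) = ≢-sym x≢y , inj₁ y∈x

  nonadjacent⇒∉E : ∀ {y w} → y ≢ w → ¬ PowerAdj A y w → ¬ E A y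
  nonadjacent⇒∉E y≢w y≁w y∈E = y≁w (y≢w , inj₁ (E⊆∈⟨⟩ y∈E))

  power-P3-middle : ∀ {x y z} → InducedP3 (PowerAdj A) x y z →
                    (y ∈⟨ x ⟩ × y ∈⟨ z ⟩) ⊎ (x ∈⟨ y ⟩ × z ∈⟨ y ⟩)
  power-P3-middle (x≢z , (_ , inj₁ x∈y) , (_ , inj₁ y∈z) , x≁z) =
    ⊥-elim (x≁z (x≢z , inj₁ (∈⟨⟩-trans x∈y y∈z)))
  power-P3-middle (_   , (_ , inj₁ x∈y) , (_ , inj₂ z∈y) , _)   = inj₂ (x∈y , z∈y)
  power-P3-middle (_   , (_ , inj₂ y∈x) , (_ , inj₁ y∈z) , _)   = inj₁ (y∈x , y∈z)
  power-P3-middle (x≢z , (_ , inj₂ y∈x) , (_ , inj₂ z∈y) , x≁z) =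
    ⊥-elim (x≁z (x≢z , inj₂ (∈⟨⟩-trans z∈y y∈x)))

  enhanced-P3-middle-below : SameGraph (PowerAdj A) (EnhancedAdj A) →
                             ∀ {x y z} → InducedP3 (PowerAdj A) x y z →
                             y ∈⟨ x ⟩ × y ∈⟨ z ⟩
  enhanced-P3-middle-below P=En {y = y} p@(x≢z , _ , _ , x≁z) with power-P3-middle p
  ... | inj₁ below        = below
  ... | inj₂ (x∈y , z∈y) =
    ⊥-elim (x≁z (Equivalence.from (P=En _ _) (x≢z , y , x∈y , z∈y)))

  intersection-P3-middle-above : SameGraph (PowerAdj A) (IntersectionAdj A) →
                                 ∀ {x y z} → ¬ E A y → InducedP3 (PowerAdj A) x y z →
                                 x ∈⟨ y ⟩ × z ∈⟨ y ⟩
  intersection-P3-middle-above P=In {y = y} y∉E p@(x≢z , _ , _ , x≁z) with power-P3-middle p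
  ... | inj₂ above       = above
  ... | inj₁ (y∈x , y∈z) =
    ⊥-elim (x≁z (Equivalence.from (P=In _ _) (x≢z , inj₂ (inj₂ (y , y∈x , y∈z , y∉E)))))

  enhanced⇒cograph : SameGraph (PowerAdj A) (EnhancedAdj A) → IsCograph (PowerAdj A)
  enhanced⇒cograph P=En a b c d (_ , a≢c , _ , _ , b≢d , _ , a~b , b~c , c~d , a≁c , b≁d , _)
    with enhanced-P3-middle-below P=En (a≢c , a~b , b~c , a≁c)
       | enhanced-P3-middle-below P=En (b≢d , b~c , c~d , b≁d)
  ... | b∈a , _ | c∈b , _ = a≁c (a≢c , inj₂ (∈⟨⟩-trans c∈b b∈a))

  intersection⇒cograph : SameGraph (PowerAdj A) (IntersectionAdj A) → IsCograph (PowerAdj A)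
  intersection⇒cograph P=In a b c d (_ , a≢c , _ , _ , b≢d , _ , a~b , b~c , c~d , a≁c , b≁d , _)
    with intersection-P3-middle-above P=In (nonadjacent⇒∉E b≢d b≁d)
           (a≢c , a~b , b~c , a≁c)
       | intersection-P3-middle-above P=In (nonadjacent⇒∉E (≢-sym a≢c) (a≁c ∘ PowerAdj-sym))
           (b≢d , b~c , c~d , b≁d)
  ... | a∈b , _ | b∈c , _ = a≁c (a≢c , inj₁ (∈⟨⟩-trans a∈b b∈c))

mainTheorem4 : {n : ℕ} (A : FiniteAlgebra n) →
    SameGraph (PowerAdj A) (EnhancedAdj A) ⊎ SameGraph (PowerAdj A) (IntersectionAdj A) →
    IsCograph (PowerAdj A)
mainTheorem4 A (inj₁ P=En) = enhanced⇒cograph A P=En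
mainTheorem4 A (inj₂ P=In) = intersection⇒cograph A P=In
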